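{- For every integer $n \geq 7$, $rsat(n,C_6) \leq 2n-2+2\varepsilon$, where $\varepsilon\in\{0,1,2\}$ satisfies $\varepsilon \equiv n-1 \pmod 3$.
   Context: All graphs are finite, simple and undirected. An edge-coloring of a graph $G$ is a function $\mathcal{C}:E(G)\to\mathbb{N}$; a (sub)graph is rainbow if all its edges have distinct colors. An edge-colored graph $G$ is $F$-rainbow saturated if it contains no rainbow copy of $F$ but adding any nonedge of $G$ with any color on it creates a rainbow copy of $F$. $rsat(n,F)$ is the minimum number of edges of a graph on $n$ vertices admitting an edge-coloring that makes it $F$-rainbow saturated. $C_r$ is the cycle on $r$ vertices. -}

module Defs where

open import Data.Nat using (ℕ; zero; suc; _+_; _*_; _∸_; _≤_; _<_; _<?_)
open import Data.Nat.DivMod using (_%_)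
open import Data.Fin using (Fin; zero; suc; toℕ; fromℕ<; _≟_)
open import Data.Bool using (Bool; true; false; _∧_; _∨_; if_then_else_)
open import Data.List using (List; map; allFin)
open import Data.Nat.ListAction using (sum)
open import Data.Product using (Σ; _×_; _,_; ∃)
open import Function.Definitions using (Injective)
open import Relation.Nullary using (¬_; yes; no)
open import Relation.Nullary.Decidable using (⌊_⌋)
open import Relation.Binary.PropositionalEquality using (_≡_; _≢_)

record Graph (n : ℕ) : Set where
  field
    adj     : Fin n → Fin n → Bool
    adj-sym : ∀ x y → adj x y ≡ adj y x
    adj-irr : ∀ x → adj x x ≡ false
open Graph public

edgeCount : ∀ {n} → Graph n → ℕ
edgeCount {n} G =
  sum (map (λ x → sum (map (λ y →
    if ⌊ toℕ x <? toℕ y ⌋ ∧ adj G x y then 1 else 0) (allFin n))) (allFin n))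

-- An edge-coloring: colors on (ordered) vertex pairs, required symmetric;
-- only its values on edges matter.
Coloring : ℕ → Set
Coloring n = Fin n → Fin n → ℕ

SymColoring : ∀ {n} → Coloring n → Set
SymColoring {n} C = ∀ (x y : Fin n) → C x y ≡ C y x

samePair : ∀ {n} → Fin n → Fin n → Fin n → Fin n → Bool
samePair u v x y = (⌊ x ≟ u ⌋ ∧ ⌊ y ≟ v ⌋) ∨ (⌊ x ≟ v ⌋ ∧ ⌊ y ≟ u ⌋)

addEdge : ∀ {n} → Graph n → (u v : Fin n) → u ≢ v → Graph n
addEdge G u v u≢v = record
  { adj = λ x y → adj G x y ∨ samePair u v x y
  ; adj-sym = sym'
  ; adj-irr = irr'
  }
  where
  open import Relation.Binary.PropositionalEquality using (refl; cong₂; sym)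
  open import Data.Bool.Properties using (∨-comm)
  sp-sym : ∀ x y → samePair u v x y ≡ samePair u v y x
  sp-sym x y with x ≟ u | y ≟ v | x ≟ v | y ≟ u
  ... | yes _ | yes _ | yes _ | yes _ = refl
  ... | yes _ | yes _ | yes _ | no  _ = refl
  ... | yes _ | yes _ | no  _ | yes _ = refl
  ... | yes _ | yes _ | no  _ | no  _ = refl
  ... | yes _ | no  _ | yes _ | yes _ = refl
  ... | yes _ | no  _ | yes _ | no  _ = refl
  ... | yes _ | no  _ | no  _ | yes _ = refl
  ... | yes _ | no  _ | no  _ | no  _ = refl
  ... | no  _ | yes _ | yes _ | yes _ = refl
  ... | no  _ | yes _ | yes _ | no  _ = refl
  ... | no  _ | yes _ | no  _ | yes _ = refl
  ... | no  _ | yes _ | no  _ | no  _ = refl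
  ... | no  _ | no  _ | yes _ | yes _ = refl
  ... | no  _ | no  _ | yes _ | no  _ = refl
  ... | no  _ | no  _ | no  _ | yes _ = refl
  ... | no  _ | no  _ | no  _ | no  _ = refl
  sym' : ∀ x y → (adj G x y ∨ samePair u v x y) ≡ (adj G y x ∨ samePair u v y x)
  sym' x y = cong₂ _∨_ (adj-sym G x y) (sp-sym x y)
  sp-irr : ∀ x → samePair u v x x ≡ false
  sp-irr x with x ≟ u | x ≟ v
  ... | yes refl | yes refl = Data.Empty.⊥-elim (u≢v refl)
    where import Data.Empty
  ... | yes _ | no _ = refl
  ... | no _ | yes _ = refl
  ... | no _ | no _ = refl
  irr' : ∀ x → (adj G x x ∨ samePair u v x x) ≡ false
  irr' x rewrite adj-irr G x | sp-irr x = refl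

recolor : ∀ {n} → Coloring n → (u v : Fin n) → ℕ → Coloring n
recolor C u v c x y = if samePair u v x y then c else C x y

next : ∀ {m} → Fin (suc m) → Fin (suc m)
next {m} i with suc (toℕ i) <? suc m
... | yes p = fromℕ< p
... | no  _ = zero

-- A rainbow copy of the cycle C_(suc m) in the edge-colored graph (G , C):
-- an injective map of the cycle's vertices 0,1,...,m into V(G) such that
-- consecutive vertices (cyclically) are adjacent, and the colors of the
-- suc m cycle edges are pairwise distinct.
RainbowCycle : ∀ {n} (m : ℕ) → Graph n → Coloring n → Set
RainbowCycle {n} m G C =
  Σ (Fin (suc m) → Fin n) λ f →
    Injective _≡_ _≡_ f
    × (∀ i → adj G (f i) (f (next i)) ≡ true)
    × (∀ i j → i ≢ j → C (f i) (f (next i)) ≢ C (f j) (f (next j)))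

RainbowSaturated : ∀ {n} (m : ℕ) → Graph n → Coloring n → Set
RainbowSaturated {n} m G C =
  ¬ RainbowCycle m G C
  × (∀ (u v : Fin n) (u≢v : u ≢ v) → adj G u v ≡ false → ∀ (c : ℕ) →
       RainbowCycle m (addEdge G u v u≢v) (recolor C u v c))

rsatCycle≤ : (n m b : ℕ) → Set
rsatCycle≤ n m b =
  Σ (Graph n) λ G → edgeCount G ≤ b ×
    Σ (Coloring n) λ C → SymColoring C × RainbowSaturated m G C

{-# OPTIONS --safe #-}
module Submission where

-- The graph is a windmill: a hub joined to all vertices of disjoint cliques
-- ("blocks") of sizes 3 and 4, with all edges coloured differently.  A 6-cycle
-- would need five vertices of one block besides the hub, so there is none.  A
-- nonedge uv joins two blocks; triangles u a a′ and v b b′ together with the hub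
-- span a copy of the windmill with two triangles, which has three u–v paths of
-- length 5 with no edge common to all of them.  The new colour of uv equals the
-- colour of at most one old edge, so one of the paths avoids it and closes to a
-- rainbow C₆.  Writing N = n − 1 = 4ε + 3t, the windmill with ε blocks of size 4
-- and t of size 3 has N + 6ε + 3t = 2N + 2ε edges.

open import Defs
open import Data.Bool using (Bool; true; false; _∧_; _∨_; not; if_then_else_)
import Data.Bool as Bool
open import Data.Bool.Properties using (∧-conicalʳ; ∨-zeroʳ)
open import Data.Empty using (⊥-elim)
open import Data.Fin
  using (Fin; zero; suc; toℕ; fromℕ; fromℕ<; inject₁; punchOut; lift; _↑ˡ_; _↑ʳ_; splitAt; join; _≟_)
open import Data.Fin.Patterns using (0F; 1F; 2F; 3F; 4F; 5F; 6F)
open import Data.Fin.Properties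
  using ( toℕ-injective; suc-injective; toℕ<n; toℕ-inject₁; toℕ-fromℕ; toℕ-fromℕ<; inject₁ℕ<
        ; inject₁-injective; fromℕ≢inject₁; ↑ˡ-injective; toℕ-↑ˡ; join-splitAt; lift-injective
        ; punchIn-punchOut; injective⇒≤; any?; all? )
open import Data.List using (List; []; _∷_; _++_; map; allFin; replicate)
open import Data.List.Properties using (map-tabulate; map-cong)
open import Data.List.Relation.Unary.All using (All; []; _∷_)
open import Data.List.Relation.Unary.All.Properties using (++⁺; replicate⁺)
open import Data.Nat using (ℕ; zero; suc; _≤_; _<_; _+_; _*_; _∸_)
import Data.Nat as ℕ
import Data.Nat.Properties as ℕ
open import Data.Nat.Combinatorics using (_C_; nC1≡n; nCk+nC[k+1]≡[n+1]C[k+1])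
open import Data.Nat.DivMod using (_%_; _/_; m<n⇒m%n≡m; [m+kn]%n≡m%n; m%n<n; m≡m%n+[m/n]*n; /-monoˡ-≤)
open import Data.Nat.ListAction using (sum)
open import Data.Nat.Tactic.RingSolver using (solve-∀)
open import Data.Product using (∃; _×_; _,_; proj₁; proj₂)
import Data.Product as Product
open import Data.Sum using (_⊎_; inj₁; inj₂; [_,_]′)
import Data.Sum as Sum
open import Data.Vec using ([]; _∷_; lookup)
open import Data.Vec.Relation.Unary.All using ([]; _∷_)
open import Data.Vec.Relation.Unary.AllPairs using ([]; _∷_)
open import Data.Vec.Relation.Unary.Unique.Propositional using (Unique)
open import Data.Vec.Relation.Unary.Unique.Propositional.Properties using (lookup-injective)
open import Function using (_∘_; id)
open import Function.Definitions using (Injective)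
open import Relation.Binary.Definitions using (DecidableEquality)
open import Relation.Binary.PropositionalEquality
open import Relation.Nullary using (¬_; Dec; yes; no; does; contradiction; ¬?)
open import Relation.Nullary.Decidable
  using (⌊_⌋; dec-true; dec-false; isYes≗does; map′; from-yes; _×-dec_; _⊎-dec_; _→-dec_)

private
  variable
    n k m : ℕ

-- Cycles and paths

data LastOrInject₁ : Fin (suc m) → Set where
  last  : LastOrInject₁ (fromℕ m)
  inner : (j : Fin m) → LastOrInject₁ (inject₁ j)

lastOrInject₁ : (i : Fin (suc m)) → LastOrInject₁ i
lastOrInject₁ {zero}  zero    = last
lastOrInject₁ {suc m} zero    = inner zero
lastOrInject₁ {suc m} (suc i) with lastOrInject₁ i
... | last    = last
... | inner j = inner (suc j)

next-inject₁ : (j : Fin m) → next (inject₁ j) ≡ suc j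
next-inject₁ {m} j with suc (toℕ (inject₁ j)) ℕ.<? suc m
... | yes p = toℕ-injective (trans (toℕ-fromℕ< p) (cong suc (toℕ-inject₁ j)))
... | no ¬p = contradiction (ℕ.s<s (inject₁ℕ< j)) ¬p

next-fromℕ : ∀ m → next (fromℕ m) ≡ zero
next-fromℕ m with suc (toℕ (fromℕ m)) ℕ.<? suc m
... | yes p = contradiction (subst (ℕ._< m) (toℕ-fromℕ m) (ℕ.s<s⁻¹ p)) (ℕ.<-irrefl refl)
... | no _  = refl

next-injective : Injective _≡_ _≡_ (next {m})
next-injective {m} {i} {j} e with lastOrInject₁ i | lastOrInject₁ j
... | last    | last     = refl
... | last    | inner j′ = contradiction (trans (sym (next-fromℕ m)) (trans e (next-inject₁ j′))) λ ()
... | inner i′ | last    = contradiction (trans (sym (next-fromℕ m)) (trans (sym e) (next-inject₁ i′))) λ ()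
... | inner i′ | inner j′ =
  cong inject₁ (suc-injective (trans (sym (next-inject₁ i′)) (trans e (next-inject₁ j′))))

IsCycle : ∀ m → Graph n → (Fin (suc m) → Fin n) → Set
IsCycle m G f = Injective _≡_ _≡_ f × (∀ i → adj G (f i) (f (next i)) ≡ true)

IsPath : Graph n → (Fin (suc k) → Fin n) → Set
IsPath G p = Injective _≡_ _≡_ p × (∀ j → adj G (p (inject₁ j)) (p (suc j)) ≡ true)

rainbowCycle⇒cycle : ∀ {G : Graph n} {χ} → RainbowCycle m G χ → ∃ (IsCycle m G)
rainbowCycle⇒cycle (f , f-inj , f-adj , _) = f , f-inj , f-adj

module _ {G : Graph n} where

  rotate : ∀ {f} → IsCycle m G f → IsCycle m G (f ∘ next)
  rotate (f-inj , f-adj) = next-injective ∘ f-inj , f-adj ∘ next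

  rotateTo : ∀ {f} → IsCycle m G f → ∀ i → ∃ λ g → IsCycle m G g × g zero ≡ f i
  rotateTo c i = go (toℕ i) c i refl
    where
    go : ∀ t {f} → IsCycle m G f → ∀ i → toℕ i ≡ t → ∃ λ g → IsCycle m G g × g zero ≡ f i
    go zero    c zero    _ = _ , c , refl
    go (suc t) {f} c (suc j) e with go t (rotate c) (inject₁ j) (trans (toℕ-inject₁ j) (ℕ.suc-injective e))
    ... | g , g-cycle , g₀ = g , g-cycle , trans g₀ (cong f (next-inject₁ j))

  cycle⇒tailPath : ∀ {f} → IsCycle (suc k) G f → IsPath G (f ∘ suc)
  cycle⇒tailPath {f = f} (f-inj , f-adj) = suc-injective ∘ f-inj , λ j →
    subst (λ i → adj G (f (inject₁ (suc j))) (f i) ≡ true) (next-inject₁ (suc j)) (f-adj (inject₁ (suc j)))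

cone : Graph n → Graph (suc n)
cone {n} G = record { adj = adjᶜ ; adj-sym = adjᶜ-sym ; adj-irr = adjᶜ-irr }
  where
  adjᶜ : Fin (suc n) → Fin (suc n) → Bool
  adjᶜ zero    zero    = false
  adjᶜ zero    (suc _) = true
  adjᶜ (suc _) zero    = true
  adjᶜ (suc x) (suc y) = adj G x y

  adjᶜ-sym : ∀ x y → adjᶜ x y ≡ adjᶜ y x
  adjᶜ-sym zero    zero    = refl
  adjᶜ-sym zero    (suc _) = refl
  adjᶜ-sym (suc _) zero    = refl
  adjᶜ-sym (suc x) (suc y) = adj-sym G x y

  adjᶜ-irr : ∀ x → adjᶜ x x ≡ false
  adjᶜ-irr zero    = refl
  adjᶜ-irr (suc x) = adj-irr G x

module _ {G : Graph n} where

  cone-path⇒path : ∀ {q : Fin (suc k) → Fin (suc n)} → IsPath (cone G) q → (∀ j → q j ≢ zero) →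
    ∃ (IsPath G)
  cone-path⇒path {q = q} (q-inj , q-adj) q≢0 = p , p-inj , p-adj
    where
    p : _ → Fin n
    p j = punchOut (q≢0 j ∘ sym)

    q≡suc-p : ∀ j → q j ≡ suc (p j)
    q≡suc-p j = sym (punchIn-punchOut (q≢0 j ∘ sym))

    p-inj : Injective _≡_ _≡_ p
    p-inj e = q-inj (trans (q≡suc-p _) (trans (cong suc e) (sym (q≡suc-p _))))

    p-adj : ∀ j → adj G (p (inject₁ j)) (p (suc j)) ≡ true
    p-adj j = subst₂ (λ a b → adj (cone G) a b ≡ true) (q≡suc-p _) (q≡suc-p _) (q-adj j)

  cone-cycle⇒path : ∀ {f} → IsCycle (suc k) (cone G) f → ∃ (IsPath {k = k} G)
  cone-cycle⇒path {f = f} c with any? (λ i → f i ≟ zero)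
  ... | no hub∉f = cone-path⇒path (cycle⇒tailPath {G = cone G} c) (λ j e → hub∉f (suc j , e))
  ... | yes (i , fi≡hub) with rotateTo {G = cone G} c i
  ...   | g , g-cycle , g₀≡fi = cone-path⇒path (cycle⇒tailPath {G = cone G} g-cycle)
    (λ j e → contradiction (proj₁ g-cycle (trans g₀≡fi (trans fi≡hub (sym e)))) λ ())

-- Windmills

-- The blocks are consecutive intervals of ℕ whose lengths are listed in L:
-- block L x is the index of the block containing x, and toBlockEnd L x the
-- number of points after x in it.
block : List ℕ → ℕ → ℕ
block []          x       = 0
block (zero  ∷ L) x       = suc (block L x)
block (suc s ∷ L) zero    = 0
block (suc s ∷ L) (suc x) = block (s ∷ L) x

toBlockEnd : List ℕ → ℕ → ℕ
toBlockEnd []          x       = 0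
toBlockEnd (zero  ∷ L) x       = toBlockEnd L x
toBlockEnd (suc s ∷ L) zero    = s
toBlockEnd (suc s ∷ L) (suc x) = toBlockEnd (s ∷ L) x

block-first : ∀ {s L y} → y < s → block (s ∷ L) y ≡ 0
block-first {suc s} {L} {zero}  _             = refl
block-first {suc s} {L} {suc y} (ℕ.s≤s y<s) = block-first {s} {L} y<s

block≡0⇒first : ∀ s L y → block (s ∷ L) y ≡ 0 → y < s
block≡0⇒first (suc s) L zero    _ = ℕ.z<s
block≡0⇒first (suc s) L (suc y) e = ℕ.s<s (block≡0⇒first s L y e)

toBlockEnd-first : ∀ s L y → y < s → suc (y + toBlockEnd (s ∷ L) y) ≡ s
toBlockEnd-first (suc s) L zero    _             = refl
toBlockEnd-first (suc s) L (suc y) (ℕ.s≤s y<s) = cong suc (toBlockEnd-first s L y y<s)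

toBlockEnd< : ∀ {b L x} → All (_≤ b) L → x < sum L → toBlockEnd L x < b
toBlockEnd< {L = zero  ∷ L}         (_ ∷ bnd)   x<    = toBlockEnd< bnd x<
toBlockEnd< {L = suc s ∷ L} {zero}  (s<b ∷ _)   _     = s<b
toBlockEnd< {L = suc s ∷ L} {suc x} (s<b ∷ bnd) x<    =
  toBlockEnd< (ℕ.≤-trans (ℕ.n≤1+n s) s<b ∷ bnd) (ℕ.s<s⁻¹ x<)

block-toBlockEnd-injective : ∀ L {x y} → x < sum L → y < sum L →
  block L x ≡ block L y → toBlockEnd L x ≡ toBlockEnd L y → x ≡ y
block-toBlockEnd-injective (zero  ∷ L) x< y< eb er = block-toBlockEnd-injective L x< y< (ℕ.suc-injective eb) er
block-toBlockEnd-injective (suc s ∷ L) {zero}  {zero}  _ _ _ _ = refl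
block-toBlockEnd-injective (suc s ∷ L) {zero}  {suc y} _ _ eb er =
  contradiction (trans (cong (λ r → suc (y + r)) er) (toBlockEnd-first s L y (block≡0⇒first s L y (sym eb))))
                (ℕ.m≢1+n+m s ∘ sym)
block-toBlockEnd-injective (suc s ∷ L) {suc x} {zero}  _ _ eb er =
  contradiction (trans (cong (λ r → suc (x + r)) (sym er)) (toBlockEnd-first s L x (block≡0⇒first s L x eb)))
                (ℕ.m≢1+n+m s ∘ sym)
block-toBlockEnd-injective (suc s ∷ L) {suc x} {suc y} x< y< eb er =
  cong suc (block-toBlockEnd-injective (s ∷ L) (ℕ.s<s⁻¹ x<) (ℕ.s<s⁻¹ y<) eb er)

does-sym : ∀ {A : Set} (_≟′_ : DecidableEquality A) x y → does (x ≟′ y) ≡ does (y ≟′ x)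
does-sym _≟′_ x y with x ≟′ y | y ≟′ x
... | yes _   | yes _   = refl
... | no  _   | no  _   = refl
... | yes x≡y | no  y≢x = contradiction (sym x≡y) y≢x
... | no  x≢y | yes y≡x = contradiction (sym y≡x) x≢y

does⇒ : ∀ {A : Set} (a? : Dec A) → does a? ≡ true → A
does⇒ (yes a) _  = a
does⇒ (no _)  ()

-- With does rather than ⌊_⌋, the subgraph of cliques (suc s ∷ L) on the vertices
-- suc x is cliques (s ∷ L) up to definitional equality.
cliques : (L : List ℕ) → Graph (sum L)
cliques L = record
  { adj     = λ x y → not (does (x ≟ y)) ∧ does (block L (toℕ x) ℕ.≟ block L (toℕ y))
  ; adj-sym = λ x y → cong₂ (λ a b → not a ∧ b) (does-sym _≟_ x y) (does-sym ℕ._≟_ (block L (toℕ x)) _)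
  ; adj-irr = λ x → cong (λ a → not a ∧ does (block L (toℕ x) ℕ.≟ block L (toℕ x))) (dec-true (x ≟ x) refl)
  }

windmill : (L : List ℕ) → Graph (suc (sum L))
windmill L = cone (cliques L)

adj⇒≢ : ∀ (G : Graph n) {x y} → adj G x y ≡ true → x ≢ y
adj⇒≢ G e refl = contradiction (trans (sym e) (adj-irr G _)) λ ()

module _ (L : List ℕ) where

  adj⇒sameBlock : ∀ {x y} → adj (cliques L) x y ≡ true → block L (toℕ x) ≡ block L (toℕ y)
  adj⇒sameBlock {x} e = does⇒ (_ ℕ.≟ _) (∧-conicalʳ (not (does (x ≟ _))) _ e)

  sameBlock⇒adj : ∀ {x y} → x ≢ y → block L (toℕ x) ≡ block L (toℕ y) → adj (cliques L) x y ≡ true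
  sameBlock⇒adj {x} {y} x≢y same
    rewrite dec-false (x ≟ y) x≢y | dec-true (block L (toℕ x) ℕ.≟ block L (toℕ y)) same = refl

module _ {L : List ℕ} where

  path-sameBlock : ∀ {p : Fin (suc k) → Fin (sum L)} → (∀ j → adj (cliques L) (p (inject₁ j)) (p (suc j)) ≡ true) →
    ∀ j → block L (toℕ (p j)) ≡ block L (toℕ (p zero))
  path-sameBlock p-adj zero = refl
  path-sameBlock {k = suc k} p-adj (suc j) =
    trans (path-sameBlock (p-adj ∘ suc) j) (sym (adj⇒sameBlock L (p-adj zero)))

  cliques-path-length : ∀ {b} {p : Fin (suc k) → Fin (sum L)} → All (_≤ b) L → IsPath (cliques L) p → suc k ≤ b
  cliques-path-length {k = k} {b = b} {p} bnd (p-inj , p-adj) = injective⇒≤ r-inj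
    where
    r : Fin (suc k) → Fin b
    r j = fromℕ< (toBlockEnd< bnd (toℕ<n (p j)))

    r-inj : Injective _≡_ _≡_ r
    r-inj {i} {j} e = p-inj (toℕ-injective (block-toBlockEnd-injective L (toℕ<n (p i)) (toℕ<n (p j))
      (trans (path-sameBlock p-adj i) (sym (path-sameBlock p-adj j)))
      (trans (sym (toℕ-fromℕ< _)) (trans (cong toℕ e) (toℕ-fromℕ< _)))))

windmill-cycle-length : ∀ {L b f} → All (_≤ b) L → IsCycle (suc k) (windmill L) f → suc k ≤ b
windmill-cycle-length bnd c = cliques-path-length bnd (proj₂ (cone-cycle⇒path c))

-- Edge counts

removeZero : Graph (suc n) → Graph n
removeZero G = record
  { adj     = λ x y → adj G (suc x) (suc y)
  ; adj-sym = λ x y → adj-sym G (suc x) (suc y)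
  ; adj-irr = adj-irr G ∘ suc
  }

sum-allFin-suc : (f : Fin (suc n) → ℕ) →
  sum (map f (allFin (suc n))) ≡ f zero + sum (map (f ∘ suc) (allFin n))
sum-allFin-suc f =
  cong (λ xs → f zero + sum xs) (trans (map-tabulate suc f) (sym (map-tabulate id (f ∘ suc))))

sum-allFin-const : ∀ n c → sum (map (λ (_ : Fin n) → c) (allFin n)) ≡ n * c
sum-allFin-const zero    c = refl
sum-allFin-const (suc n) c = trans (sum-allFin-suc {n} (λ _ → c)) (cong (c +_) (sum-allFin-const n c))

edgeCount-removeZero : (G : Graph (suc n)) →
  edgeCount G ≡ sum (map (λ y → if adj G zero (suc y) then 1 else 0) (allFin n)) + edgeCount (removeZero G)
edgeCount-removeZero {n} G =
  trans (sum-allFin-suc row)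
        (cong₂ _+_ (sum-allFin-suc (entry zero))
                   (cong sum (map-cong (λ x → trans (sum-allFin-suc (entry (suc x)))
                                                    (cong sum (map-cong (entry-suc x) (allFin n))))
                                       (allFin n))))
  where
  entry : Fin (suc n) → Fin (suc n) → ℕ
  entry x y = if ⌊ toℕ x ℕ.<? toℕ y ⌋ ∧ adj G x y then 1 else 0

  row : Fin (suc n) → ℕ
  row x = sum (map (entry x) (allFin (suc n)))

  entry-suc : ∀ x y →
    entry (suc x) (suc y) ≡ (if ⌊ toℕ x ℕ.<? toℕ y ⌋ ∧ adj G (suc x) (suc y) then 1 else 0)
  entry-suc x y =
    cong (λ b → if b ∧ adj G (suc x) (suc y) then 1 else 0)
         (trans (isYes≗does (suc (toℕ x) ℕ.<? suc (toℕ y))) (sym (isYes≗does (toℕ x ℕ.<? toℕ y))))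

edgeCount-cone : (G : Graph n) → edgeCount (cone G) ≡ n + edgeCount G
edgeCount-cone {n} G =
  trans (edgeCount-removeZero (cone G))
        (cong (_+ edgeCount G) (trans (sum-allFin-const n 1) (ℕ.*-identityʳ n)))

count-firstBlock : ∀ s L →
  sum (map (λ (y : Fin (s + sum L)) → if 0 ℕ.≡ᵇ block (s ∷ L) (toℕ y) then 1 else 0) (allFin (s + sum L))) ≡ s
count-firstBlock zero    L = trans (sum-allFin-const (sum L) 0) (ℕ.*-zeroʳ (sum L))
count-firstBlock (suc s) L =
  trans (sum-allFin-suc {s + sum L} (λ y → if 0 ℕ.≡ᵇ block (suc s ∷ L) (toℕ y) then 1 else 0))
        (cong suc (count-firstBlock s L))

edgeCount-cliques-∷ : ∀ s L → edgeCount (cliques (s ∷ L)) ≡ s C 2 + edgeCount (cliques L)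
edgeCount-cliques-∷ zero    L = refl
edgeCount-cliques-∷ (suc s) L = begin
  edgeCount (cliques (suc s ∷ L))        ≡⟨ edgeCount-removeZero (cliques (suc s ∷ L)) ⟩
  _ + edgeCount (cliques (s ∷ L))        ≡⟨ cong₂ _+_ (count-firstBlock s L) (edgeCount-cliques-∷ s L) ⟩
  s + (s C 2 + edgeCount (cliques L))    ≡⟨ ℕ.+-assoc s (s C 2) _ ⟨
  s + s C 2 + edgeCount (cliques L)      ≡⟨ cong (λ a → a + s C 2 + edgeCount (cliques L)) (nC1≡n s) ⟨
  s C 1 + s C 2 + edgeCount (cliques L)  ≡⟨ cong (_+ edgeCount (cliques L)) (nCk+nC[k+1]≡[n+1]C[k+1] s 1) ⟩
  suc s C 2 + edgeCount (cliques L)      ∎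
  where open ≡-Reasoning

edgeCount-cliques : ∀ L → edgeCount (cliques L) ≡ sum (map (_C 2) L)
edgeCount-cliques []      = refl
edgeCount-cliques (s ∷ L) = trans (edgeCount-cliques-∷ s L) (cong (s C 2 +_) (edgeCount-cliques L))

edgeCount-windmill : ∀ L → edgeCount (windmill L) ≡ sum L + sum (map (_C 2) L)
edgeCount-windmill L = trans (edgeCount-cone (cliques L)) (cong (sum L +_) (edgeCount-cliques L))

-- Injective colourings

SamePair : Fin n → Fin n → Fin n → Fin n → Set
SamePair p q r s = (p ≡ r × q ≡ s) ⊎ (p ≡ s × q ≡ r)

PairInjective : Coloring n → Set
PairInjective χ = ∀ {p q r s} → χ p q ≡ χ r s → SamePair p q r s

digits-injective : ∀ {a b c d} K .{{_ : ℕ.NonZero K}} → a < K → c < K →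
  a + b * K ≡ c + d * K → a ≡ c × b ≡ d
digits-injective {a} {b} {c} {d} K a<K c<K e =
  a≡c , ℕ.*-cancelʳ-≡ b d K (ℕ.+-cancelˡ-≡ a _ _ (trans e (cong (_+ d * K) (sym a≡c))))
  where
  open ≡-Reasoning
  a≡c : a ≡ c
  a≡c = begin
    a                ≡⟨ m<n⇒m%n≡m a<K ⟨
    a % K            ≡⟨ [m+kn]%n≡m%n a b K ⟨
    (a + b * K) % K  ≡⟨ cong (_% K) e ⟩
    (c + d * K) % K  ≡⟨ [m+kn]%n≡m%n c d K ⟩
    c % K            ≡⟨ m<n⇒m%n≡m c<K ⟩
    c                ∎

⊓-⊔-injective : ∀ {a b c d} → a ℕ.⊓ b ≡ c ℕ.⊓ d → a ℕ.⊔ b ≡ c ℕ.⊔ d →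
  (a ≡ c × b ≡ d) ⊎ (a ≡ d × b ≡ c)
⊓-⊔-injective {a} {b} {c} {d} e⊓ e⊔ with ℕ.≤-total a b | ℕ.≤-total c d
... | inj₁ a≤b | inj₁ c≤d
  rewrite ℕ.m≤n⇒m⊓n≡m a≤b | ℕ.m≤n⇒m⊔n≡n a≤b | ℕ.m≤n⇒m⊓n≡m c≤d | ℕ.m≤n⇒m⊔n≡n c≤d = inj₁ (e⊓ , e⊔)
... | inj₁ a≤b | inj₂ d≤c
  rewrite ℕ.m≤n⇒m⊓n≡m a≤b | ℕ.m≤n⇒m⊔n≡n a≤b | ℕ.m≥n⇒m⊓n≡n d≤c | ℕ.m≥n⇒m⊔n≡m d≤c = inj₂ (e⊓ , e⊔)
... | inj₂ b≤a | inj₁ c≤d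
  rewrite ℕ.m≥n⇒m⊓n≡n b≤a | ℕ.m≥n⇒m⊔n≡m b≤a | ℕ.m≤n⇒m⊓n≡m c≤d | ℕ.m≤n⇒m⊔n≡n c≤d = inj₂ (e⊔ , e⊓)
... | inj₂ b≤a | inj₂ d≤c
  rewrite ℕ.m≥n⇒m⊓n≡n b≤a | ℕ.m≥n⇒m⊔n≡m b≤a | ℕ.m≥n⇒m⊓n≡n d≤c | ℕ.m≥n⇒m⊔n≡m d≤c = inj₁ (e⊔ , e⊓)

pairCode : Coloring n
pairCode {n} p q = toℕ p ℕ.⊓ toℕ q + (toℕ p ℕ.⊔ toℕ q) * n

pairCode-sym : SymColoring (pairCode {n})
pairCode-sym p q = cong₂ (λ a b → a + b * _) (ℕ.⊓-comm (toℕ p) (toℕ q)) (ℕ.⊔-comm (toℕ p) (toℕ q))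

pairCode-injective : PairInjective (pairCode {n})
pairCode-injective {suc n} {p} {q} {r} {s} e
  with digits-injective (suc n) (ℕ.≤-<-trans (ℕ.m⊓n≤m _ _) (toℕ<n p))
                                (ℕ.≤-<-trans (ℕ.m⊓n≤m _ _) (toℕ<n r)) e
... | e⊓ , e⊔ with ⊓-⊔-injective e⊓ e⊔
...   | inj₁ (p≡r , q≡s) = inj₁ (toℕ-injective p≡r , toℕ-injective q≡s)
...   | inj₂ (p≡s , q≡r) = inj₂ (toℕ-injective p≡s , toℕ-injective q≡r)

⌊≟⌋-refl : ∀ (x : Fin n) → ⌊ x ≟ x ⌋ ≡ true
⌊≟⌋-refl x = trans (isYes≗does (x ≟ x)) (dec-true (x ≟ x) refl)

⌊≟⌋-injective : ∀ {σ : Fin m → Fin n} → Injective _≡_ _≡_ σ → ∀ a b → ⌊ σ a ≟ σ b ⌋ ≡ ⌊ a ≟ b ⌋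
⌊≟⌋-injective {σ = σ} σ-inj a b with a ≟ b
... | yes refl = ⌊≟⌋-refl (σ a)
... | no  a≢b  = trans (isYes≗does (σ a ≟ σ b)) (dec-false (σ a ≟ σ b) (a≢b ∘ σ-inj))

samePair-swap : ∀ (u v : Fin n) → samePair u v v u ≡ true
samePair-swap u v =
  trans (cong₂ (λ a b → (⌊ v ≟ u ⌋ ∧ ⌊ u ≟ v ⌋) ∨ (a ∧ b)) (⌊≟⌋-refl v) (⌊≟⌋-refl u)) (∨-zeroʳ _)

samePair⇒ : ∀ {u v x y : Fin n} → samePair u v x y ≡ true → SamePair x y u v
samePair⇒ {u = u} {v} {x} {y} e with x ≟ u | y ≟ v | x ≟ v | y ≟ u
... | yes x≡u | yes y≡v | _       | _       = inj₁ (x≡u , y≡v)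
... | _       | _       | yes x≡v | yes y≡u = inj₂ (x≡v , y≡u)
samePair⇒ () | no _  | _    | no _  | _
samePair⇒ () | no _  | _    | yes _ | no _
samePair⇒ () | yes _ | no _ | no _  | _
samePair⇒ () | yes _ | no _ | yes _ | no _

samePair-injective : ∀ {σ : Fin m → Fin n} → Injective _≡_ _≡_ σ → ∀ u v x y →
  samePair (σ u) (σ v) (σ x) (σ y) ≡ samePair u v x y
samePair-injective σ-inj u v x y =
  cong₂ _∨_ (cong₂ _∧_ (⌊≟⌋-injective σ-inj x u) (⌊≟⌋-injective σ-inj y v))
            (cong₂ _∧_ (⌊≟⌋-injective σ-inj x v) (⌊≟⌋-injective σ-inj y u))

edgeColour : Coloring n → (Fin (suc k) → Fin n) → Fin k → ℕ
edgeColour χ p j = χ (p (inject₁ j)) (p (suc j))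

RainbowPath : Coloring n → (Fin (suc k) → Fin n) → Set
RainbowPath χ p = ∀ i j → i ≢ j → edgeColour χ p i ≢ edgeColour χ p j

Avoids : Coloring n → (Fin (suc k) → Fin n) → ℕ → Set
Avoids χ p c = ∀ j → c ≢ edgeColour χ p j

closePath : ∀ {G : Graph n} {χ c} {p : Fin (3 + m) → Fin n} (p₀≢pₗ : p zero ≢ p (fromℕ (2 + m))) →
  IsPath G p → RainbowPath χ p → Avoids χ p c →
  RainbowCycle (2 + m) (addEdge G (p zero) (p (fromℕ (2 + m))) p₀≢pₗ)
                       (recolor χ (p zero) (p (fromℕ (2 + m))) c)
closePath {m = m} {G = G} {χ} {c} {p} p₀≢pₗ (p-inj , p-adj) rainbow avoids =
  p , p-inj , cycle-adj , cycle-rainbow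
  where
  u = p zero
  v = p (fromℕ (2 + m))

  inner≢uv : ∀ j → ¬ SamePair (p (inject₁ j)) (p (suc j)) u v
  inner≢uv j       (inj₂ (pj≡v , _)) = fromℕ≢inject₁ (sym (p-inj pj≡v))
  inner≢uv zero    (inj₁ (_ , p₁≡v)) = contradiction (suc-injective (p-inj p₁≡v)) λ ()
  inner≢uv (suc j) (inj₁ (pj≡u , _)) = contradiction (p-inj pj≡u) λ ()

  colour-last : recolor χ u v c (p (fromℕ (2 + m))) (p (next (fromℕ (2 + m)))) ≡ c
  colour-last rewrite next-fromℕ (2 + m) = cong (λ b → if b then c else χ v u) (samePair-swap u v)

  colour-inner : ∀ j → recolor χ u v c (p (inject₁ j)) (p (next (inject₁ j))) ≡ edgeColour χ p j
  colour-inner j rewrite next-inject₁ j with samePair u v (p (inject₁ j)) (p (suc j)) in e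
  ... | false = refl
  ... | true  = contradiction (samePair⇒ e) (inner≢uv j)

  cycle-adj : ∀ i → adj (addEdge G u v p₀≢pₗ) (p i) (p (next i)) ≡ true
  cycle-adj i with lastOrInject₁ i
  ... | last    rewrite next-fromℕ (2 + m) = trans (cong (adj G v u ∨_) (samePair-swap u v)) (∨-zeroʳ _)
  ... | inner j rewrite next-inject₁ j | p-adj j = refl

  cycle-rainbow : ∀ i i′ → i ≢ i′ →
    recolor χ u v c (p i) (p (next i)) ≢ recolor χ u v c (p i′) (p (next i′))
  cycle-rainbow i i′ with lastOrInject₁ i | lastOrInject₁ i′
  ... | last    | last     = λ i≢i′ _ → i≢i′ refl
  ... | last    | inner j  = λ _ e → avoids j (trans (sym colour-last) (trans e (colour-inner j)))
  ... | inner j | last     = λ _ e → avoids j (trans (sym colour-last) (trans (sym e) (colour-inner j)))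
  ... | inner j | inner j′ = λ i≢i′ e →
    rainbow j j′ (i≢i′ ∘ cong inject₁) (trans (sym (colour-inner j)) (trans e (colour-inner j′)))

pairInjective⇒rainbowPath : ∀ {χ : Coloring n} {p : Fin (suc k) → Fin n} →
  PairInjective χ → Injective _≡_ _≡_ p → RainbowPath χ p
pairInjective⇒rainbowPath {p = p} χ-inj p-inj i j i≢j e with χ-inj e
... | inj₁ (pᵢ≡pⱼ , _) = i≢j (inject₁-injective (p-inj pᵢ≡pⱼ))
... | inj₂ (pᵢ≡pⱼ₊₁ , pᵢ₊₁≡pⱼ) =
  ℕ.<-asym (ℕ.≤-reflexive (sym (trans (sym (toℕ-inject₁ i)) (cong toℕ (p-inj pᵢ≡pⱼ₊₁)))))
           (ℕ.≤-reflexive (trans (cong toℕ (p-inj pᵢ₊₁≡pⱼ)) (toℕ-inject₁ j)))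

avoids-or-hits : ∀ (χ : Coloring n) (p : Fin (suc k) → Fin n) c → Avoids χ p c ⊎ ∃ λ j → c ≡ edgeColour χ p j
avoids-or-hits χ p c with any? (λ j → c ℕ.≟ edgeColour χ p j)
... | yes hit  = inj₂ hit
... | no  ¬hit = inj₁ (λ j e → ¬hit (j , e))

NoCommonEdge : (p₁ p₂ p₃ : Fin (suc k) → Fin n) → Set
NoCommonEdge p₁ p₂ p₃ = ∀ j₁ j₂ j₃ →
  ¬ (SamePair (p₁ (inject₁ j₁)) (p₁ (suc j₁)) (p₂ (inject₁ j₂)) (p₂ (suc j₂))
   × SamePair (p₁ (inject₁ j₁)) (p₁ (suc j₁)) (p₃ (inject₁ j₃)) (p₃ (suc j₃)))

someAvoids : ∀ {χ : Coloring n} {p₁ p₂ p₃ : Fin (suc k) → Fin n} → PairInjective χ → NoCommonEdge p₁ p₂ p₃ →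
  ∀ c → Avoids χ p₁ c ⊎ Avoids χ p₂ c ⊎ Avoids χ p₃ c
someAvoids {χ = χ} {p₁} {p₂} {p₃} χ-inj none c
  with avoids-or-hits χ p₁ c | avoids-or-hits χ p₂ c | avoids-or-hits χ p₃ c
... | inj₁ a | _      | _      = inj₁ a
... | inj₂ _ | inj₁ a | _      = inj₂ (inj₁ a)
... | inj₂ _ | inj₂ _ | inj₁ a = inj₂ (inj₂ a)
... | inj₂ (j₁ , c≡χ₁) | inj₂ (j₂ , c≡χ₂) | inj₂ (j₃ , c≡χ₃) =
  ⊥-elim (none j₁ j₂ j₃ (χ-inj (trans (sym c≡χ₁) c≡χ₂) , χ-inj (trans (sym c≡χ₁) c≡χ₃)))

-- Embeddings

Hom : Graph m → Graph n → (Fin m → Fin n) → Set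
Hom H G σ = ∀ x y → adj H x y ≡ true → adj G (σ x) (σ y) ≡ true

embed-rainbowCycle : ∀ {H : Graph m} {G : Graph n} {σ : Fin m → Fin n} {χ : Coloring n} {x y c} →
  Injective _≡_ _≡_ σ → Hom H G σ → (x≢y : x ≢ y) (σx≢σy : σ x ≢ σ y) →
  RainbowCycle k (addEdge H x y x≢y) (recolor (λ a b → χ (σ a) (σ b)) x y c) →
  RainbowCycle k (addEdge G (σ x) (σ y) σx≢σy) (recolor χ (σ x) (σ y) c)
embed-rainbowCycle {H = H} {G} {σ} {χ} {x} {y} {c} σ-inj σ-hom _ _ (f , f-inj , f-adj , f-rainbow) =
  σ ∘ f , f-inj ∘ σ-inj , (λ i → edge (f-adj i)) , rainbow
  where
  edge : ∀ {a b} → adj H a b ∨ samePair x y a b ≡ true →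
    adj G (σ a) (σ b) ∨ samePair (σ x) (σ y) (σ a) (σ b) ≡ true
  edge {a} {b} e rewrite samePair-injective σ-inj x y a b with adj H a b in ab
  ... | true  = cong (_∨ samePair x y a b) (σ-hom a b ab)
  ... | false = trans (cong (adj G (σ a) (σ b) ∨_) e) (∨-zeroʳ _)

  colour : ∀ a b → recolor χ (σ x) (σ y) c (σ a) (σ b) ≡ recolor (λ a b → χ (σ a) (σ b)) x y c a b
  colour a b = cong (λ t → if t then c else χ (σ a) (σ b)) (samePair-injective σ-inj x y a b)

  rainbow : ∀ i j → i ≢ j →
    recolor χ (σ x) (σ y) c (σ (f i)) (σ (f (next i))) ≢ recolor χ (σ x) (σ y) c (σ (f j)) (σ (f (next j)))
  rainbow i j i≢j e = f-rainbow i j i≢j (trans (sym (colour _ _)) (trans e (colour _ _)))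

cone-hom : ∀ {H : Graph m} {G : Graph n} {τ} → Hom H G τ → Hom (cone H) (cone G) (lift 1 τ)
cone-hom τ-hom zero    zero    ()
cone-hom τ-hom zero    (suc _) _ = refl
cone-hom τ-hom (suc _) zero    _ = refl
cone-hom τ-hom (suc x) (suc y) e = τ-hom x y e

cliques-hom : ∀ {K L} {τ : Fin (sum K) → Fin (sum L)} (β : ℕ → ℕ) → Injective _≡_ _≡_ τ →
  (∀ x → block L (toℕ (τ x)) ≡ β (block K (toℕ x))) → Hom (cliques K) (cliques L) τ
cliques-hom {K} {L} β τ-inj τ-block x y e =
  sameBlock⇒adj L (adj⇒≢ (cliques K) e ∘ τ-inj)
    (trans (τ-block x) (trans (cong β (adj⇒sameBlock K e)) (sym (τ-block y))))

pairInjective-∘ : ∀ {σ : Fin m → Fin n} {χ : Coloring n} → Injective _≡_ _≡_ σ → PairInjective χ →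
  PairInjective (λ a b → χ (σ a) (σ b))
pairInjective-∘ σ-inj χ-inj = Sum.map (Product.map σ-inj σ-inj) (Product.map σ-inj σ-inj) ∘ χ-inj

-- Saturation

record Triangle (G : Graph n) (x : Fin n) : Set where
  constructor triangle
  field
    a b : Fin n
    xa  : adj G x a ≡ true
    xb  : adj G x b ≡ true
    ab  : adj G a b ≡ true

cliques-↑ˡ : ∀ {s L} {i j : Fin s} → i ≢ j → adj (cliques (s ∷ L)) (i ↑ˡ sum L) (j ↑ˡ sum L) ≡ true
cliques-↑ˡ {s} {L} {i} {j} i≢j =
  sameBlock⇒adj (s ∷ L) (i≢j ∘ ↑ˡ-injective (sum L) i j) (trans (first i) (sym (first j)))
  where
  first : ∀ i → block (s ∷ L) (toℕ (i ↑ˡ sum L)) ≡ 0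
  first i = trans (cong (block (s ∷ L)) (toℕ-↑ˡ i (sum L))) (block-first (toℕ<n i))

cliques-↑ʳ : ∀ s {L} a b → adj (cliques (s ∷ L)) (s ↑ʳ a) (s ↑ʳ b) ≡ adj (cliques L) a b
cliques-↑ʳ zero    a b = refl
cliques-↑ʳ (suc s) a b = cliques-↑ʳ s a b

triangle-↑ˡ : ∀ {s L} → 3 ≤ s → (i : Fin s) → Triangle (cliques (s ∷ L)) (i ↑ˡ sum L)
triangle-↑ˡ {s} {L} (ℕ.s≤s (ℕ.s≤s (ℕ.s≤s _))) i = corners i
  where
  edge : ∀ i j → i ≢ j → adj (cliques (s ∷ L)) (i ↑ˡ sum L) (j ↑ˡ sum L) ≡ true
  edge i j = cliques-↑ˡ {s} {L} {i} {j}

  corners : ∀ i → Triangle (cliques (s ∷ L)) (i ↑ˡ sum L)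
  corners 0F = triangle (1F ↑ˡ sum L) (2F ↑ˡ sum L) (edge 0F 1F λ ()) (edge 0F 2F λ ()) (edge 1F 2F λ ())
  corners 1F = triangle (0F ↑ˡ sum L) (2F ↑ˡ sum L) (edge 1F 0F λ ()) (edge 1F 2F λ ()) (edge 0F 2F λ ())
  corners i@(suc (suc _)) =
    triangle (0F ↑ˡ sum L) (1F ↑ˡ sum L) (edge i 0F λ ()) (edge i 1F λ ()) (edge 0F 1F λ ())

triangle-↑ʳ : ∀ s {L x} → Triangle (cliques L) x → Triangle (cliques (s ∷ L)) (s ↑ʳ x)
triangle-↑ʳ s {x = x} (triangle a b xa xb ab) =
  triangle (s ↑ʳ a) (s ↑ʳ b)
           (trans (cliques-↑ʳ s x a) xa) (trans (cliques-↑ʳ s x b) xb) (trans (cliques-↑ʳ s a b) ab)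

cliques-triangle : ∀ {L} → All (3 ≤_) L → ∀ x → Triangle (cliques L) x
cliques-triangle {s ∷ L} (3≤s ∷ 3≤L) x =
  subst (Triangle (cliques (s ∷ L))) (join-splitAt s (sum L) x) (fromSplit (splitAt s x))
  where
  fromSplit : (y : Fin s ⊎ Fin (sum L)) → Triangle (cliques (s ∷ L)) (join s (sum L) y)
  fromSplit (inj₁ i) = triangle-↑ˡ 3≤s i
  fromSplit (inj₂ j) = triangle-↑ʳ s (cliques-triangle 3≤L j)

injective? : (f : Fin m → Fin n) → Dec (Injective _≡_ _≡_ f)
injective? f = map′ (λ inj {i} {j} → inj i j) (λ inj i j → inj)
                    (all? λ i → all? λ j → (f i ≟ f j) →-dec (i ≟ j))

isPath? : (G : Graph n) (p : Fin (suc k) → Fin n) → Dec (IsPath G p)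
isPath? G p = injective? p ×-dec all? (λ j → adj G (p (inject₁ j)) (p (suc j)) Bool.≟ true)

samePair? : (p q r s : Fin n) → Dec (SamePair p q r s)
samePair? p q r s = (p ≟ r ×-dec q ≟ s) ⊎-dec (p ≟ s ×-dec q ≟ r)

noCommonEdge? : (p₁ p₂ p₃ : Fin (suc k) → Fin n) → Dec (NoCommonEdge p₁ p₂ p₃)
noCommonEdge? p₁ p₂ p₃ = all? λ j₁ → all? λ j₂ → all? λ j₃ →
  ¬? (samePair? (p₁ (inject₁ j₁)) (p₁ (suc j₁)) (p₂ (inject₁ j₂)) (p₂ (suc j₂))
  ×-dec samePair? (p₁ (inject₁ j₁)) (p₁ (suc j₁)) (p₃ (inject₁ j₃)) (p₃ (suc j₃)))

-- In windmill (3 ∷ 3 ∷ []) the hub is 0 and the triangles are {1, 2, 3} and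
-- {4, 5, 6}.  The edges common to p₁ and p₂ are 12 and 05, and p₃ avoids both.
windmill₃₃-addEdge-rainbowC₆ : ∀ {χ : Coloring 7} → PairInjective χ → ∀ c →
  RainbowCycle 5 (addEdge (windmill (3 ∷ 3 ∷ [])) 1F 4F (λ ())) (recolor χ 1F 4F c)
windmill₃₃-addEdge-rainbowC₆ {χ} χ-inj c =
  [ close p₁ (λ ()) (from-yes (isPath? H p₁))
  , [ close p₂ (λ ()) (from-yes (isPath? H p₂)) , close p₃ (λ ()) (from-yes (isPath? H p₃)) ]′
  ]′ (someAvoids {p₁ = p₁} {p₂} {p₃} χ-inj (from-yes (noCommonEdge? p₁ p₂ p₃)) c)
  where
  H : Graph 7
  H = windmill (3 ∷ 3 ∷ [])

  p₁ p₂ p₃ : Fin 6 → Fin 7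
  p₁ = lookup (1F ∷ 2F ∷ 3F ∷ 0F ∷ 5F ∷ 4F ∷ [])
  p₂ = lookup (1F ∷ 2F ∷ 0F ∷ 5F ∷ 6F ∷ 4F ∷ [])
  p₃ = lookup (1F ∷ 3F ∷ 0F ∷ 6F ∷ 5F ∷ 4F ∷ [])

  close : (p : Fin 6 → Fin 7) (p₀≢p₅ : p 0F ≢ p 5F) → IsPath H p → Avoids χ p c →
    RainbowCycle 5 (addEdge H (p 0F) (p 5F) p₀≢p₅) (recolor χ (p 0F) (p 5F) c)
  close p p₀≢p₅ p-path =
    closePath {G = H} {χ = χ} {p = p} p₀≢p₅ p-path (pairInjective⇒rainbowPath χ-inj (proj₁ p-path))

module _ {L : List ℕ} {x y : Fin (sum L)} (tx : Triangle (cliques L) x) (ty : Triangle (cliques L) y) where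
  open Triangle

  private
    B : Fin (sum L) → ℕ
    B v = block L (toℕ v)

  twoTriangles : Fin 6 → Fin (sum L)
  twoTriangles = lookup (x ∷ a tx ∷ b tx ∷ y ∷ a ty ∷ b ty ∷ [])

  twoTriangles-injective : B x ≢ B y → Injective _≡_ _≡_ twoTriangles
  twoTriangles-injective Bx≢By {i} {j} = lookup-injective distinct i j
    where
    apart : ∀ {p q} → B p ≡ B x → B q ≡ B y → p ≢ q
    apart Bp Bq p≡q = Bx≢By (trans (sym Bp) (trans (cong B p≡q) Bq))

    ≢a : ∀ {z} (t : Triangle (cliques L) z) → z ≢ a t
    ≢a t = adj⇒≢ (cliques L) (xa t)
    ≢b : ∀ {z} (t : Triangle (cliques L) z) → z ≢ b t
    ≢b t = adj⇒≢ (cliques L) (xb t)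
    a≢b : ∀ {z} (t : Triangle (cliques L) z) → a t ≢ b t
    a≢b t = adj⇒≢ (cliques L) (ab t)
    Ba : ∀ {z} (t : Triangle (cliques L) z) → B (a t) ≡ B z
    Ba t = sym (adj⇒sameBlock L (xa t))
    Bb : ∀ {z} (t : Triangle (cliques L) z) → B (b t) ≡ B z
    Bb t = sym (adj⇒sameBlock L (xb t))

    distinct : Unique (x ∷ a tx ∷ b tx ∷ y ∷ a ty ∷ b ty ∷ [])
    distinct = (≢a tx ∷ ≢b tx ∷ apart refl refl ∷ apart refl (Ba ty) ∷ apart refl (Bb ty) ∷ [])
             ∷ (a≢b tx ∷ apart (Ba tx) refl ∷ apart (Ba tx) (Ba ty) ∷ apart (Ba tx) (Bb ty) ∷ [])
             ∷ (apart (Bb tx) refl ∷ apart (Bb tx) (Ba ty) ∷ apart (Bb tx) (Bb ty) ∷ [])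
             ∷ (≢a ty ∷ ≢b ty ∷ [])
             ∷ (a≢b ty ∷ [])
             ∷ []
             ∷ []

  sideBlock : ℕ → ℕ
  sideBlock zero    = B x
  sideBlock (suc _) = B y

  twoTriangles-block : ∀ i → B (twoTriangles i) ≡ sideBlock (block (3 ∷ 3 ∷ []) (toℕ i))
  twoTriangles-block 0F = refl
  twoTriangles-block 1F = sym (adj⇒sameBlock L (xa tx))
  twoTriangles-block 2F = sym (adj⇒sameBlock L (xb tx))
  twoTriangles-block 3F = refl
  twoTriangles-block 4F = sym (adj⇒sameBlock L (xa ty))
  twoTriangles-block 5F = sym (adj⇒sameBlock L (xb ty))

windmill-addEdge-rainbowC₆ : ∀ {L} → All (3 ≤_) L →
  ∀ u v (u≢v : u ≢ v) → adj (windmill L) u v ≡ false → ∀ c →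
  RainbowCycle 5 (addEdge (windmill L) u v u≢v) (recolor pairCode u v c)
windmill-addEdge-rainbowC₆ _ zero    zero    u≢v _  _ = contradiction refl u≢v
windmill-addEdge-rainbowC₆ _ zero    (suc _) _   () _
windmill-addEdge-rainbowC₆ _ (suc _) zero    _   () _
windmill-addEdge-rainbowC₆ {L} 3≤L (suc x) (suc y) u≢v xy-nonadjacent c =
  embed-rainbowCycle {H = windmill (3 ∷ 3 ∷ [])} {G = windmill L} {σ = σ} {χ = pairCode}
    σ-inj σ-hom (λ ()) u≢v
    (windmill₃₃-addEdge-rainbowC₆ (pairInjective-∘ {σ = σ} σ-inj pairCode-injective) c)
  where
  tx : Triangle (cliques L) x
  tx = cliques-triangle 3≤L x

  ty : Triangle (cliques L) y
  ty = cliques-triangle 3≤L y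

  blocks-differ : block L (toℕ x) ≢ block L (toℕ y)
  blocks-differ same =
    contradiction (trans (sym (sameBlock⇒adj L (u≢v ∘ cong suc) same)) xy-nonadjacent) λ ()

  τ : Fin 6 → Fin (sum L)
  τ = twoTriangles {L} tx ty

  τ-inj : Injective _≡_ _≡_ τ
  τ-inj = twoTriangles-injective {L} tx ty blocks-differ

  σ : Fin 7 → Fin (suc (sum L))
  σ = lift 1 τ

  σ-inj : Injective _≡_ _≡_ σ
  σ-inj = lift-injective τ τ-inj 1

  σ-hom : Hom (windmill (3 ∷ 3 ∷ [])) (windmill L) σ
  σ-hom = cone-hom (cliques-hom {K = 3 ∷ 3 ∷ []} {L} (sideBlock {L} tx ty) τ-inj
                                (twoTriangles-block {L} tx ty))

windmill-rainbowSaturated : ∀ {L} → All (3 ≤_) L → All (_≤ 4) L → RainbowSaturated 5 (windmill L) pairCode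
windmill-rainbowSaturated {L} 3≤L ≤4 = no-C₆ , windmill-addEdge-rainbowC₆ 3≤L
  where
  no-C₆ : ¬ RainbowCycle 5 (windmill L) pairCode
  no-C₆ rc =
    ℕ.<-irrefl refl (windmill-cycle-length ≤4 (proj₂ (rainbowCycle⇒cycle {G = windmill L} {χ = pairCode} rc)))

windmill-rsat : ∀ {L} → All (3 ≤_) L → All (_≤ 4) L → rsatCycle≤ (suc (sum L)) 5 (edgeCount (windmill L))
windmill-rsat {L} 3≤L ≤4 =
  windmill L , ℕ.≤-refl , pairCode , pairCode-sym , windmill-rainbowSaturated 3≤L ≤4

-- Blocks of sizes 3 and 4

blocks : ℕ → ℕ → List ℕ
blocks r t = replicate r 4 ++ replicate t 3

sum-blocks : ∀ r t → sum (blocks r t) ≡ r * 4 + t * 3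
sum-blocks zero    zero    = refl
sum-blocks zero    (suc t) = cong (3 +_) (sum-blocks zero t)
sum-blocks (suc r) t       = cong (4 +_) (sum-blocks r t)

sum-C2-blocks : ∀ r t → sum (map (_C 2) (blocks r t)) ≡ r * 6 + t * 3
sum-C2-blocks zero    zero    = refl
sum-C2-blocks zero    (suc t) = cong (3 +_) (sum-C2-blocks zero t)
sum-C2-blocks (suc r) t       = cong (6 +_) (sum-C2-blocks r t)

edgeCount-windmill-blocks : ∀ r t → edgeCount (windmill (blocks r t)) ≡ 2 * sum (blocks r t) + 2 * r
edgeCount-windmill-blocks r t = begin
  edgeCount (windmill (blocks r t))                 ≡⟨ edgeCount-windmill (blocks r t) ⟩
  sum (blocks r t) + sum (map (_C 2) (blocks r t))  ≡⟨ cong₂ _+_ (sum-blocks r t) (sum-C2-blocks r t) ⟩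
  (r * 4 + t * 3) + (r * 6 + t * 3)                 ≡⟨ regroup r t ⟩
  2 * (r * 4 + t * 3) + 2 * r                       ≡⟨ cong (λ s → 2 * s + 2 * r) (sum-blocks r t) ⟨
  2 * sum (blocks r t) + 2 * r                      ∎
  where
  open ≡-Reasoning
  regroup : ∀ r t → (r * 4 + t * 3) + (r * 6 + t * 3) ≡ 2 * (r * 4 + t * 3) + 2 * r
  regroup = solve-∀

windmill-blocks-rsat : ∀ r t → rsatCycle≤ (suc (sum (blocks r t))) 5 (2 * sum (blocks r t) + 2 * r)
windmill-blocks-rsat r t = subst (rsatCycle≤ _ 5) (edgeCount-windmill-blocks r t)
  (windmill-rsat (++⁺ (replicate⁺ r (ℕ.n≤1+n 3)) (replicate⁺ t ℕ.≤-refl))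
                 (++⁺ (replicate⁺ r ℕ.≤-refl) (replicate⁺ t (ℕ.n≤1+n 3))))

mod3-decomposition : ∀ {N} → 6 ≤ N → N ≡ (N % 3) * 4 + (N / 3 ∸ N % 3) * 3
mod3-decomposition {N} 6≤N = begin
  N                ≡⟨ m≡m%n+[m/n]*n N 3 ⟩
  r + N / 3 * 3    ≡⟨ cong (λ q → r + q * 3) (ℕ.m+[n∸m]≡n r≤q) ⟨
  r + (r + t) * 3  ≡⟨ regroup r t ⟩
  r * 4 + t * 3    ∎
  where
  open ≡-Reasoning
  r = N % 3
  t = N / 3 ∸ r

  r≤q : r ≤ N / 3
  r≤q = ℕ.≤-trans (ℕ.s≤s⁻¹ (m%n<n N 3)) (/-monoˡ-≤ 3 6≤N)

  regroup : ∀ r t → r + (r + t) * 3 ≡ r * 4 + t * 3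
  regroup = solve-∀

theorem1p4 : (n : ℕ) → 7 ≤ n →
    rsatCycle≤ n 5 (2 * n ∸ 2 + 2 * ((n ∸ 1) % 3))
theorem1p4 (suc N) (ℕ.s≤s 6≤N) =
  subst₂ (λ n b → rsatCycle≤ n 5 b) (cong suc size) (cong (_+ 2 * r) double) (windmill-blocks-rsat r t)
  where
  r = N % 3
  t = N / 3 ∸ r

  size : sum (blocks r t) ≡ N
  size = trans (sum-blocks r t) (sym (mod3-decomposition 6≤N))

  double : 2 * sum (blocks r t) ≡ 2 * suc N ∸ 2
  double = trans (cong (2 *_) size) (ℕ.*-distribˡ-∸ 2 (suc N) 1)
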